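{- Let $G=\{0,1,\dots,q-1\}$. For each of the following combinations of $k$ and $q$: (i) $k\ge4$ even and $q=k-2$; (ii) $k\ge5$ odd and $q=k-3$; (iii) $k\ge6$ even and $q=k-4$, both the odd predicate $P'_{odd}=\{y\in G^k: |\{i:y_i=0\}| \text{ odd}\}$ and the even predicate $P'_{even}=\{y\in G^k:|\{i:y_i=0\}|\text{ even}\}$ support a balanced pairwise independent distribution on $G^k$.
   Context: A distribution $\mu$ on $G^k$ is balanced pairwise independent if for $x\sim\mu$, $\Pr[x_i=g]=1/|G|$ for all $i$ and $g\in G$, and $\Pr[x_i=g,x_j=g']=1/|G|^2$ for all $i\ne j$ and $g,g'\in G$. A predicate $P$ supports $\mu$ if $\mu$ is supported inside $P$. -}

module Defs where

open import Data.Nat using (ℕ; zero; suc; _%_)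
open import Data.Fin using (Fin; toℕ)
open import Data.Fin.Properties using () renaming (_≟_ to _≟ᶠ_)
open import Data.Vec using (Vec; []; _∷_; lookup; count)
open import Data.List using (List; []; _∷_; map; concatMap; foldr)
open import Data.List.Base using (allFin)
open import Data.Integer using (+_)
open import Data.Rational using (ℚ; _/_; 0ℚ; 1ℚ; _+_; _≤_)
open import Data.Bool using (if_then_else_)
open import Relation.Nullary.Decidable using (⌊_⌋; _×-dec_)
open import Relation.Binary.PropositionalEquality using (_≡_; _≢_)
open import Data.Product using (_×_)
import Data.Nat as ℕ

allVecs : (k q : ℕ) → List (Vec (Fin q) k)
allVecs zero    q = [] ∷ []
allVecs (suc k) q = concatMap (λ g → map (g ∷_) (allVecs k q)) (allFin q)

sumAll : (k q : ℕ) → (Vec (Fin q) k → ℚ) → ℚ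
sumAll k q f = foldr (λ x acc → f x + acc) 0ℚ (allVecs k q)

IsDistribution : (k q : ℕ) → (Vec (Fin q) k → ℚ) → Set
IsDistribution k q μ = (∀ x → 0ℚ ≤ μ x) × sumAll k q μ ≡ 1ℚ

Pr₁ : (k q : ℕ) → (Vec (Fin q) k → ℚ) → Fin k → Fin q → ℚ
Pr₁ k q μ i g = sumAll k q (λ x → if ⌊ lookup x i ≟ᶠ g ⌋ then μ x else 0ℚ)

Pr₂ : (k q : ℕ) → (Vec (Fin q) k → ℚ) → Fin k → Fin q → Fin k → Fin q → ℚ
Pr₂ k q μ i g j g' =
  sumAll k q (λ x → if ⌊ (lookup x i ≟ᶠ g) ×-dec (lookup x j ≟ᶠ g') ⌋ then μ x else 0ℚ)

-- The rational number 1/n (for n ≥ 1; the value at n = 0 is irrelevant here).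
inv : ℕ → ℚ
inv zero    = 0ℚ
inv (suc n) = + 1 / suc n

BalancedPairwiseIndependent : (k q : ℕ) → (Vec (Fin q) k → ℚ) → Set
BalancedPairwiseIndependent k q μ =
  IsDistribution k q μ
  × (∀ (i : Fin k) (g : Fin q) → Pr₁ k q μ i g ≡ inv q)
  × (∀ (i j : Fin k) → i ≢ j → ∀ (g g' : Fin q) → Pr₂ k q μ i g j g' ≡ inv (q ℕ.* q))

Supports : (k q : ℕ) → (Vec (Fin q) k → Set) → (Vec (Fin q) k → ℚ) → Set
Supports k q P μ = ∀ x → μ x ≢ 0ℚ → P x

SupportsBPI : (k q : ℕ) → (Vec (Fin q) k → Set) → Set
SupportsBPI k q P = Data.Product.Σ (Vec (Fin q) k → ℚ)
  (λ μ → BalancedPairwiseIndependent k q μ × Supports k q P μ)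

numZeros : {k q : ℕ} → Vec (Fin q) k → ℕ
numZeros = count (λ g → toℕ g ℕ.≟ 0)

P'odd : (k q : ℕ) → Vec (Fin q) k → Set
P'odd k q y = numZeros y % 2 ≡ 1

P'even : (k q : ℕ) → Vec (Fin q) k → Set
P'even k q y = numZeros y % 2 ≡ 0

-- Let μ(y) be proportional to ψ(number of zeros of y). Such a μ is invariant under
-- permutations of the coordinates and of the nonzero values, so it is balanced pairwise
-- independent as soon as the number of zeros Z has the first two factorial moments of a
-- Binomial(k, 1/q) variable, E Z = k/q and E Z(Z-1) = k(k-1)/q²: by double counting,
-- these say that the vectors with one (two) prescribed zero coordinates carry mass 1/q
-- (1/q²). Supporting μ on P'odd or P'even means that Z has a fixed parity, and in each
-- case a law of Z on three points of that parity, with weights polynomial in q, matches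
-- both moments.

module Submission where

open import Defs
open import Data.Bool using (true; false; if_then_else_)
open import Data.Empty using (⊥-elim)
open import Data.Fin using (Fin; zero; suc; punchOut)
open import Data.Fin.Properties using (punchIn-punchOut) renaming (_≟_ to _≟ᶠ_)
open import Data.List using (List; []; _∷_; _++_; map; concatMap; foldr; tabulate; allFin)
import Data.List as List
open import Data.List.Properties using (foldr-map)
open import Data.Nat using (ℕ; zero; suc; _+_; _*_; _≤_; _<_; z≤n; s≤s; _%_; pred; NonZero; >-nonZero; ≢-nonZero; _≟_)
open import Data.Nat.Properties
open import Data.Nat.Tactic.RingSolver using (solve-∀; solve)
open import Data.Product using (_×_; _,_; ∃-syntax)
open import Data.Rational using (ℚ; 0ℚ; 1ℚ; _/_; toℚᵘ; fromℚᵘ) renaming (_+_ to _+ℚ_; _≤_ to _≤ℚ_)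
import Data.Rational.Properties as ℚ
open import Data.Rational.Unnormalised as ℚᵘ using (mkℚᵘ; *≡*)
import Data.Rational.Unnormalised.Properties as ℚᵘ
open import Data.Sum using (_⊎_; inj₁; inj₂)
open import Data.Vec using (Vec; []; _∷_; [_]; lookup; insertAt)
open import Data.Vec.Properties using (insertAt-punchIn)
open import Function using (_∘_; id)
open import Relation.Nullary using (Dec; yes; no; ⌊_⌋)
open import Relation.Nullary.Decidable using (_×-dec_; ⌊⌋-map′)
open import Relation.Binary.PropositionalEquality hiding ([_])

module _ where

  open import Data.Integer as ℤ using (+_)
  import Data.Integer.Properties as ℤ
  import Data.Integer.Tactic.RingSolver as ℤ-Solver

  _÷_ : ℕ → (n : ℕ) .{{_ : NonZero n}} → ℚ
  a ÷ n = + a / n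

  fromℚᵘ-homo-+ : ∀ x y → fromℚᵘ (x ℚᵘ.+ y) ≡ fromℚᵘ x +ℚ fromℚᵘ y
  fromℚᵘ-homo-+ x y = ℚ.toℚᵘ-injective (begin
    toℚᵘ (fromℚᵘ (x ℚᵘ.+ y))               ≈⟨ ℚ.toℚᵘ-fromℚᵘ (x ℚᵘ.+ y) ⟩
    x ℚᵘ.+ y                               ≈⟨ ℚᵘ.+-cong (ℚ.toℚᵘ-fromℚᵘ x) (ℚ.toℚᵘ-fromℚᵘ y) ⟨
    toℚᵘ (fromℚᵘ x) ℚᵘ.+ toℚᵘ (fromℚᵘ y)   ≈⟨ ℚ.toℚᵘ-homo-+ (fromℚᵘ x) (fromℚᵘ y) ⟨
    toℚᵘ (fromℚᵘ x +ℚ fromℚᵘ y)            ∎)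
    where open ℚᵘ.≃-Reasoning

  ÷-+ : ∀ a b n .{{_ : NonZero n}} → a ÷ n +ℚ b ÷ n ≡ (a + b) ÷ n
  ÷-+ a b (suc d) = begin
    fromℚᵘ (mkℚᵘ (+ a) d) +ℚ fromℚᵘ (mkℚᵘ (+ b) d) ≡⟨ fromℚᵘ-homo-+ (mkℚᵘ (+ a) d) (mkℚᵘ (+ b) d) ⟨
    fromℚᵘ (mkℚᵘ (+ a) d ℚᵘ.+ mkℚᵘ (+ b) d)
      ≡⟨ ℚ.fromℚᵘ-cong {mkℚᵘ (+ a) d ℚᵘ.+ mkℚᵘ (+ b) d} {mkℚᵘ (+ (a + b)) d} (*≡* cross-multiplied) ⟩
    fromℚᵘ (mkℚᵘ (+ (a + b)) d)                    ∎
    where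
    open ≡-Reasoning
    n = + suc d
    distrib : ∀ x y z → (x ℤ.* z ℤ.+ y ℤ.* z) ℤ.* z ≡ (x ℤ.+ y) ℤ.* (z ℤ.* z)
    distrib = ℤ-Solver.solve-∀
    cross-multiplied : (+ a ℤ.* n ℤ.+ + b ℤ.* n) ℤ.* n ≡ + (a + b) ℤ.* (n ℤ.* n)
    cross-multiplied = trans (distrib (+ a) (+ b) n) (cong (ℤ._* (n ℤ.* n)) (sym (ℤ.pos-+ a b)))

  ÷-nonNeg : ∀ a n .{{_ : NonZero n}} → 0ℚ ≤ℚ a ÷ n
  ÷-nonNeg a n = ℚ.nonNegative⁻¹ (a ÷ n) {{ℚ.normalize-nonNeg a n}}

  ÷≡1÷ : ∀ a e n .{{_ : NonZero e}} .{{_ : NonZero n}} → e * a ≡ n → a ÷ n ≡ 1 ÷ e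
  ÷≡1÷ a (suc e) (suc d) e*a≡n = ℚ.fromℚᵘ-cong {mkℚᵘ (+ a) d} {mkℚᵘ (+ 1) e} (*≡* (begin
    + a ℤ.* + suc e  ≡⟨ ℤ.pos-* a (suc e) ⟨
    + (a * suc e)    ≡⟨ cong +_ (trans (*-comm a (suc e)) e*a≡n) ⟩
    + suc d          ≡⟨ ℤ.*-identityˡ (+ suc d) ⟨
    + 1 ℤ.* + suc d  ∎))
    where open ≡-Reasoning

  if-÷ : ∀ b a n .{{_ : NonZero n}} → (if b then a ÷ n else 0ℚ) ≡ (if b then a else 0) ÷ n
  if-÷ true  a n = refl
  if-÷ false a n = sym (ℚ.0/n≡0 n)

  if-×-dec-÷ : ∀ {P Q : Set} (P? : Dec P) (Q? : Dec Q) a n .{{_ : NonZero n}} →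
    (if ⌊ P? ×-dec Q? ⌋ then a ÷ n else 0ℚ) ≡ (if ⌊ P? ⌋ then (if ⌊ Q? ⌋ then a else 0) else 0) ÷ n
  if-×-dec-÷ (yes _) (yes _) a n = refl
  if-×-dec-÷ (yes _) (no _)  a n = sym (ℚ.0/n≡0 n)
  if-×-dec-÷ (no _)  _       a n = sym (ℚ.0/n≡0 n)

private variable A B : Set

∑ᴸ : (A → ℕ) → List A → ℕ
∑ᴸ F = foldr (λ x s → F x + s) 0

∑ᴸ-cong : {F G : A → ℕ} → (∀ x → F x ≡ G x) → ∀ xs → ∑ᴸ F xs ≡ ∑ᴸ G xs
∑ᴸ-cong F≗G []       = refl
∑ᴸ-cong F≗G (x ∷ xs) = cong₂ _+_ (F≗G x) (∑ᴸ-cong F≗G xs)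

∑ᴸ-zero : ∀ xs → ∑ᴸ (λ (_ : A) → 0) xs ≡ 0
∑ᴸ-zero []       = refl
∑ᴸ-zero (_ ∷ xs) = ∑ᴸ-zero xs

∑ᴸ-++ : ∀ (F : A → ℕ) xs ys → ∑ᴸ F (xs ++ ys) ≡ ∑ᴸ F xs + ∑ᴸ F ys
∑ᴸ-++ F []       ys = refl
∑ᴸ-++ F (x ∷ xs) ys = trans (cong (F x +_) (∑ᴸ-++ F xs ys)) (sym (+-assoc (F x) _ _))

∑ᴸ-concatMap : ∀ (F : B → ℕ) (f : A → List B) xs →
               ∑ᴸ F (concatMap f xs) ≡ ∑ᴸ (∑ᴸ F ∘ f) xs
∑ᴸ-concatMap F f []       = refl
∑ᴸ-concatMap F f (x ∷ xs) = trans (∑ᴸ-++ F (f x) _) (cong (∑ᴸ F (f x) +_) (∑ᴸ-concatMap F f xs))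

foldr-÷ : ∀ (f : A → ℚ) (F : A → ℕ) n .{{_ : NonZero n}} → (∀ x → f x ≡ F x ÷ n) →
          ∀ xs → foldr (λ x s → f x +ℚ s) 0ℚ xs ≡ ∑ᴸ F xs ÷ n
foldr-÷ f F n f≗F÷n []       = sym (ℚ.0/n≡0 n)
foldr-÷ f F n f≗F÷n (x ∷ xs) =
  trans (cong₂ _+ℚ_ (f≗F÷n x) (foldr-÷ f F n f≗F÷n xs)) (÷-+ (F x) (∑ᴸ F xs) n)

∑ᶠ : ∀ n → (Fin n → ℕ) → ℕ
∑ᶠ zero    f = 0
∑ᶠ (suc n) f = f zero + ∑ᶠ n (f ∘ suc)

∑ᴸ-tabulate : ∀ n (F : A → ℕ) (f : Fin n → A) → ∑ᴸ F (tabulate f) ≡ ∑ᶠ n (F ∘ f)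
∑ᴸ-tabulate zero    F f = refl
∑ᴸ-tabulate (suc n) F f = cong (F (f zero) +_) (∑ᴸ-tabulate n F (f ∘ suc))

∑ᶠ-cong : ∀ n {f g : Fin n → ℕ} → (∀ i → f i ≡ g i) → ∑ᶠ n f ≡ ∑ᶠ n g
∑ᶠ-cong zero    f≗g = refl
∑ᶠ-cong (suc n) f≗g = cong₂ _+_ (f≗g zero) (∑ᶠ-cong n (f≗g ∘ suc))

∑ᶠ-const : ∀ n c → ∑ᶠ n (λ _ → c) ≡ n * c
∑ᶠ-const zero    c = refl
∑ᶠ-const (suc n) c = cong (c +_) (∑ᶠ-const n c)

∑ᶠ-pick : ∀ n (f : Fin n → ℕ) i → ∑ᶠ n (λ j → if ⌊ j ≟ᶠ i ⌋ then f j else 0) ≡ f i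
∑ᶠ-pick (suc n) f zero    =
  trans (cong (f zero +_) (trans (∑ᶠ-const n 0) (*-zeroʳ n))) (+-identityʳ (f zero))
∑ᶠ-pick (suc n) f (suc i) =
  trans (∑ᶠ-cong n (λ j → cong (λ b → if b then f (suc j) else 0) (⌊⌋-map′ _ _ (j ≟ᶠ i))))
    (∑ᶠ-pick n (f ∘ suc) i)

∑ᵛ : ∀ {q} k → (Vec (Fin q) k → ℕ) → ℕ
∑ᵛ {q} k F = ∑ᴸ F (allVecs k q)

sumAll-÷ : ∀ {k q} (f : Vec (Fin q) k → ℚ) F n .{{_ : NonZero n}} → (∀ x → f x ≡ F x ÷ n) →
           sumAll k q f ≡ ∑ᵛ k F ÷ n
sumAll-÷ {k} {q} f F n f≗F÷n = foldr-÷ f F n f≗F÷n (allVecs k q)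

module _ {q : ℕ} where

  ∑ᵛ-cong : ∀ k {F G : Vec (Fin q) k → ℕ} → (∀ x → F x ≡ G x) → ∑ᵛ k F ≡ ∑ᵛ k G
  ∑ᵛ-cong k F≗G = ∑ᴸ-cong F≗G (allVecs k q)

  ∑ᵛ-suc : ∀ k (F : Vec (Fin q) (suc k) → ℕ) → ∑ᵛ (suc k) F ≡ ∑ᶠ q (λ g → ∑ᵛ k (F ∘ (g ∷_)))
  ∑ᵛ-suc k F = begin
    ∑ᴸ F (concatMap (λ g → map (g ∷_) (allVecs k q)) (allFin q))
      ≡⟨ ∑ᴸ-concatMap F (λ g → map (g ∷_) (allVecs k q)) (allFin q) ⟩
    ∑ᴸ (λ g → ∑ᴸ F (map (g ∷_) (allVecs k q))) (allFin q)
      ≡⟨ ∑ᴸ-cong (λ g → foldr-map _ (g ∷_) 0 (allVecs k q)) (allFin q) ⟩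
    ∑ᴸ (λ g → ∑ᵛ k (F ∘ (g ∷_))) (allFin q)
      ≡⟨ ∑ᴸ-tabulate q _ id ⟩
    ∑ᶠ q (λ g → ∑ᵛ k (F ∘ (g ∷_))) ∎
    where open ≡-Reasoning

  ∑ᵛ-if : ∀ k b (F : Vec (Fin q) k → ℕ) →
          ∑ᵛ k (λ y → if b then F y else 0) ≡ (if b then ∑ᵛ k F else 0)
  ∑ᵛ-if k true  F = refl
  ∑ᵛ-if k false F = ∑ᴸ-zero (allVecs k q)

  ∑ᵛ-insertAt : ∀ k i (g : Fin q) (F : Vec (Fin q) (suc k) → ℕ) →
    ∑ᵛ (suc k) (λ x → if ⌊ lookup x i ≟ᶠ g ⌋ then F x else 0) ≡ ∑ᵛ k (λ y → F (insertAt y i g))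
  ∑ᵛ-insertAt k zero g F = begin
    ∑ᵛ (suc k) (λ x → if ⌊ lookup x zero ≟ᶠ g ⌋ then F x else 0)
      ≡⟨ ∑ᵛ-suc k _ ⟩
    ∑ᶠ q (λ h → ∑ᵛ k (λ y → if ⌊ h ≟ᶠ g ⌋ then F (h ∷ y) else 0))
      ≡⟨ ∑ᶠ-cong q (λ h → ∑ᵛ-if k ⌊ h ≟ᶠ g ⌋ (F ∘ (h ∷_))) ⟩
    ∑ᶠ q (λ h → if ⌊ h ≟ᶠ g ⌋ then ∑ᵛ k (F ∘ (h ∷_)) else 0)
      ≡⟨ ∑ᶠ-pick q (λ h → ∑ᵛ k (F ∘ (h ∷_))) g ⟩
    ∑ᵛ k (F ∘ (g ∷_)) ∎
    where open ≡-Reasoning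
  ∑ᵛ-insertAt (suc k) (suc i) g F =
    trans (∑ᵛ-suc (suc k) _)
      (trans (∑ᶠ-cong q (λ h → ∑ᵛ-insertAt k i g (F ∘ (h ∷_))))
        (sym (∑ᵛ-suc k (λ y → F (insertAt y (suc i) g)))))

numZeros-insertAt : ∀ {q k} (y : Vec (Fin q) k) i g → numZeros (insertAt y i g) ≡ numZeros [ g ] + numZeros y
numZeros-insertAt y           zero    zero    = refl
numZeros-insertAt y           zero    (suc g) = refl
numZeros-insertAt (zero ∷ y)  (suc i) g       =
  trans (cong suc (numZeros-insertAt y i g)) (sym (+-suc (numZeros [ g ]) (numZeros y)))
numZeros-insertAt (suc _ ∷ y) (suc i) g       = numZeros-insertAt y i g

module ZeroCounts (q′ : ℕ) where

  ∑ᶻ : ℕ → (ℕ → ℕ) → ℕ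
  ∑ᶻ zero    ψ = ψ 0
  ∑ᶻ (suc k) ψ = ∑ᶻ k (ψ ∘ suc) + q′ * ∑ᶻ k ψ

  ∑ᵛ-numZeros : ∀ k ψ → ∑ᵛ k (λ (y : Vec (Fin (suc q′)) k) → ψ (numZeros y)) ≡ ∑ᶻ k ψ
  ∑ᵛ-numZeros zero    ψ = +-identityʳ (ψ 0)
  ∑ᵛ-numZeros (suc k) ψ = trans (∑ᵛ-suc k _)
    (cong₂ _+_ (∑ᵛ-numZeros k (ψ ∘ suc))
               (trans (∑ᶠ-const q′ _) (cong (q′ *_) (∑ᵛ-numZeros k ψ))))

  ∑ᶻ-cong : ∀ k {φ ψ : ℕ → ℕ} → (∀ j → φ j ≡ ψ j) → ∑ᶻ k φ ≡ ∑ᶻ k ψ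
  ∑ᶻ-cong zero    φ≗ψ = φ≗ψ 0
  ∑ᶻ-cong (suc k) φ≗ψ = cong₂ (λ a b → a + q′ * b) (∑ᶻ-cong k (φ≗ψ ∘ suc)) (∑ᶻ-cong k φ≗ψ)

  ∑ᶻ-+ : ∀ k φ ψ → ∑ᶻ k (λ j → φ j + ψ j) ≡ ∑ᶻ k φ + ∑ᶻ k ψ
  ∑ᶻ-+ zero    φ ψ = refl
  ∑ᶻ-+ (suc k) φ ψ = trans
    (cong₂ (λ a b → a + q′ * b) (∑ᶻ-+ k (φ ∘ suc) (ψ ∘ suc)) (∑ᶻ-+ k φ ψ))
    (interchange q′ (∑ᶻ k (φ ∘ suc)) (∑ᶻ k (ψ ∘ suc)) (∑ᶻ k φ) (∑ᶻ k ψ))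
    where
    interchange : ∀ q a b c d → (a + b) + q * (c + d) ≡ (a + q * c) + (b + q * d)
    interchange = solve-∀

  ∑ᶻ-* : ∀ k c ψ → ∑ᶻ k (λ j → c * ψ j) ≡ c * ∑ᶻ k ψ
  ∑ᶻ-* zero    c ψ = refl
  ∑ᶻ-* (suc k) c ψ = trans
    (cong₂ (λ a b → a + q′ * b) (∑ᶻ-* k c (ψ ∘ suc)) (∑ᶻ-* k c ψ))
    (factor q′ c (∑ᶻ k (ψ ∘ suc)) (∑ᶻ k ψ))
    where
    factor : ∀ q c a b → c * a + q * (c * b) ≡ c * (a + q * b)
    factor = solve-∀

  ∑ᶻ-linear₃ : ∀ k b₁ b₂ b₃ φ₁ φ₂ φ₃ →
    ∑ᶻ k (λ j → b₁ * φ₁ j + b₂ * φ₂ j + b₃ * φ₃ j) ≡ b₁ * ∑ᶻ k φ₁ + b₂ * ∑ᶻ k φ₂ + b₃ * ∑ᶻ k φ₃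
  ∑ᶻ-linear₃ k b₁ b₂ b₃ φ₁ φ₂ φ₃ = begin
    ∑ᶻ k (λ j → b₁ * φ₁ j + b₂ * φ₂ j + b₃ * φ₃ j)
      ≡⟨ ∑ᶻ-+ k (λ j → b₁ * φ₁ j + b₂ * φ₂ j) (λ j → b₃ * φ₃ j) ⟩
    ∑ᶻ k (λ j → b₁ * φ₁ j + b₂ * φ₂ j) + ∑ᶻ k (λ j → b₃ * φ₃ j)
      ≡⟨ cong₂ _+_ (∑ᶻ-+ k (λ j → b₁ * φ₁ j) (λ j → b₂ * φ₂ j)) (∑ᶻ-* k b₃ φ₃) ⟩
    ∑ᶻ k (λ j → b₁ * φ₁ j) + ∑ᶻ k (λ j → b₂ * φ₂ j) + b₃ * ∑ᶻ k φ₃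
      ≡⟨ cong₂ (λ x y → x + y + b₃ * ∑ᶻ k φ₃) (∑ᶻ-* k b₁ φ₁) (∑ᶻ-* k b₂ φ₂) ⟩
    b₁ * ∑ᶻ k φ₁ + b₂ * ∑ᶻ k φ₂ + b₃ * ∑ᶻ k φ₃ ∎
    where open ≡-Reasoning

  -- Double counting the pairs (y, i) with y i = 0.
  ∑ᶻ-falling : ∀ k ψ → suc k * ∑ᶻ k (ψ ∘ suc) ≡ ∑ᶻ (suc k) (λ j → j * ψ j)
  ∑ᶻ-falling zero    ψ = sym (trans (cong (ψ 1 + 0 +_) (*-zeroʳ q′)) (+-identityʳ _))
  ∑ᶻ-falling (suc k) ψ = begin
    suc (suc k) * X
      ≡⟨ cong (X +_) (expand (suc k) q′ (∑ᶻ k ((ψ ∘ suc) ∘ suc)) (∑ᶻ k (ψ ∘ suc))) ⟩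
    X + (suc k * ∑ᶻ k ((ψ ∘ suc) ∘ suc) + q′ * (suc k * ∑ᶻ k (ψ ∘ suc)))
      ≡⟨ cong₂ (λ a b → X + (a + q′ * b)) (∑ᶻ-falling k (ψ ∘ suc)) (∑ᶻ-falling k ψ) ⟩
    X + (∑ᶻ (suc k) (λ j → j * ψ (suc j)) + q′ * ∑ᶻ (suc k) (λ j → j * ψ j))
      ≡⟨ +-assoc X _ _ ⟨
    X + ∑ᶻ (suc k) (λ j → j * ψ (suc j)) + q′ * ∑ᶻ (suc k) (λ j → j * ψ j)
      ≡⟨ cong (_+ q′ * ∑ᶻ (suc k) (λ j → j * ψ j)) (∑ᶻ-+ (suc k) (ψ ∘ suc) (λ j → j * ψ (suc j))) ⟨
    ∑ᶻ (suc (suc k)) (λ j → j * ψ j) ∎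
    where
    open ≡-Reasoning
    X = ∑ᶻ (suc k) (ψ ∘ suc)
    expand : ∀ n q a b → n * (a + q * b) ≡ n * a + q * (n * b)
    expand = solve-∀

  ∑ᶻ-falling₂ : ∀ k ψ →
    suc (suc k) * suc k * ∑ᶻ k ((ψ ∘ suc) ∘ suc) ≡ ∑ᶻ (suc (suc k)) (λ j → j * pred j * ψ j)
  ∑ᶻ-falling₂ k ψ = begin
    suc (suc k) * suc k * ∑ᶻ k ((ψ ∘ suc) ∘ suc)
      ≡⟨ *-assoc (suc (suc k)) (suc k) _ ⟩
    suc (suc k) * (suc k * ∑ᶻ k ((ψ ∘ suc) ∘ suc))
      ≡⟨ cong (suc (suc k) *_) (∑ᶻ-falling k (ψ ∘ suc)) ⟩
    suc (suc k) * ∑ᶻ (suc k) (λ j → j * ψ (suc j))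
      ≡⟨ ∑ᶻ-falling (suc k) (λ j → pred j * ψ j) ⟩
    ∑ᶻ (suc (suc k)) (λ j → j * (pred j * ψ j))
      ≡⟨ ∑ᶻ-cong (suc (suc k)) (λ j → *-assoc j (pred j) (ψ j)) ⟨
    ∑ᶻ (suc (suc k)) (λ j → j * pred j * ψ j) ∎
    where open ≡-Reasoning

  ∑ᵛ-coordinate : ∀ k i (g : Fin (suc q′)) (ψ : ℕ → ℕ) →
    ∑ᵛ (suc k) (λ x → if ⌊ lookup x i ≟ᶠ g ⌋ then ψ (numZeros x) else 0)
      ≡ ∑ᶻ k (λ m → ψ (numZeros [ g ] + m))
  ∑ᵛ-coordinate k i g ψ = begin
    ∑ᵛ (suc k) (λ x → if ⌊ lookup x i ≟ᶠ g ⌋ then ψ (numZeros x) else 0)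
      ≡⟨ ∑ᵛ-insertAt k i g (ψ ∘ numZeros) ⟩
    ∑ᵛ k (λ y → ψ (numZeros (insertAt y i g)))
      ≡⟨ ∑ᵛ-cong k (λ y → cong ψ (numZeros-insertAt y i g)) ⟩
    ∑ᵛ k (λ y → ψ (numZeros [ g ] + numZeros y))
      ≡⟨ ∑ᵛ-numZeros k (λ m → ψ (numZeros [ g ] + m)) ⟩
    ∑ᶻ k (λ m → ψ (numZeros [ g ] + m)) ∎
    where open ≡-Reasoning

  ∑ᵛ-coordinates : ∀ k (i j : Fin (suc (suc k))) → i ≢ j → ∀ (g g′ : Fin (suc q′)) (ψ : ℕ → ℕ) →
    ∑ᵛ (suc (suc k)) (λ x → if ⌊ lookup x i ≟ᶠ g ⌋
                              then (if ⌊ lookup x j ≟ᶠ g′ ⌋ then ψ (numZeros x) else 0) else 0)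
      ≡ ∑ᶻ k (λ m → ψ (numZeros [ g ] + (numZeros [ g′ ] + m)))
  ∑ᵛ-coordinates k i j i≢j g g′ ψ = begin
    ∑ᵛ (suc (suc k)) (λ x → if ⌊ lookup x i ≟ᶠ g ⌋
                              then (if ⌊ lookup x j ≟ᶠ g′ ⌋ then ψ (numZeros x) else 0) else 0)
      ≡⟨ ∑ᵛ-insertAt (suc k) i g (λ x → if ⌊ lookup x j ≟ᶠ g′ ⌋ then ψ (numZeros x) else 0) ⟩
    ∑ᵛ (suc k) (λ y → if ⌊ lookup (insertAt y i g) j ≟ᶠ g′ ⌋ then ψ (numZeros (insertAt y i g)) else 0)
      ≡⟨ ∑ᵛ-cong (suc k) (λ y → cong₂ (λ h n → if ⌊ h ≟ᶠ g′ ⌋ then ψ n else 0)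
                                      (lookup-insertAt y) (numZeros-insertAt y i g)) ⟩
    ∑ᵛ (suc k) (λ y → if ⌊ lookup y j′ ≟ᶠ g′ ⌋ then ψ (numZeros [ g ] + numZeros y) else 0)
      ≡⟨ ∑ᵛ-coordinate k j′ g′ (λ n → ψ (numZeros [ g ] + n)) ⟩
    ∑ᶻ k (λ m → ψ (numZeros [ g ] + (numZeros [ g′ ] + m))) ∎
    where
    open ≡-Reasoning
    j′ = punchOut i≢j
    lookup-insertAt : ∀ y → lookup (insertAt y i g) j ≡ lookup y j′
    lookup-insertAt y =
      trans (cong (lookup (insertAt y i g)) (sym (punchIn-punchOut i≢j))) (insertAt-punchIn y i g j′)

δ : ℕ → ℕ → ℕ
δ zero    zero    = 1
δ zero    (suc _) = 0
δ (suc _) zero    = 0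
δ (suc m) (suc j) = δ m j

*-δ : ∀ (f : ℕ → ℕ) m j → f j * δ m j ≡ f m * δ m j
*-δ f zero    zero    = refl
*-δ f zero    (suc j) = trans (*-zeroʳ (f (suc j))) (sym (*-zeroʳ (f 0)))
*-δ f (suc m) zero    = trans (*-zeroʳ (f 0)) (sym (*-zeroʳ (f (suc m))))
*-δ f (suc m) (suc j) = *-δ (f ∘ suc) m j

δ-≢ : ∀ {m j} → m ≢ j → δ m j ≡ 0
δ-≢ {zero}  {zero}  0≢0 = ⊥-elim (0≢0 refl)
δ-≢ {zero}  {suc j} _   = refl
δ-≢ {suc m} {zero}  _   = refl
δ-≢ {suc m} {suc j} m≢j = δ-≢ (m≢j ∘ cong suc)

module _ (p : ℕ) where

  open ZeroCounts (suc p)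

  private
    q : ℕ
    q = suc (suc p)

  ∑ᶻ-δ-pos : ∀ {k m} → m ≤ k → 0 < ∑ᶻ k (δ m)
  ∑ᶻ-δ-pos {zero}  {zero}  z≤n       = s≤s z≤n
  ∑ᶻ-δ-pos {suc k} {zero}  z≤n       = <-≤-trans (∑ᶻ-δ-pos {k} z≤n)
    (≤-trans (m≤n*m (∑ᶻ k (δ 0)) (suc p)) (m≤n+m (suc p * ∑ᶻ k (δ 0)) (∑ᶻ k (δ 0 ∘ suc))))
  ∑ᶻ-δ-pos {suc k} {suc m} (s≤s m≤k) = <-≤-trans (∑ᶻ-δ-pos m≤k) (m≤m+n _ _)

  -- The total is the zero slice plus 1 + p equal nonzero slices.
  ∑ᶻ-balanced : ∀ k ψ → ∑ᶻ (suc k) ψ ≡ q * ∑ᶻ k (ψ ∘ suc) → ∑ᶻ k ψ ≡ ∑ᶻ k (ψ ∘ suc)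
  ∑ᶻ-balanced k ψ total≡q*slice₀ =
    *-cancelˡ-≡ _ _ (suc p) (+-cancelˡ-≡ (∑ᶻ k (ψ ∘ suc)) _ _ total≡q*slice₀)

  module _ (k : ℕ) (ψ : ℕ → ℕ)
           (H₁ : q * ∑ᶻ (suc k) (ψ ∘ suc) ≡ ∑ᶻ (suc (suc k)) ψ)
           (H₂ : q * q * ∑ᶻ k ((ψ ∘ suc) ∘ suc) ≡ ∑ᶻ (suc (suc k)) ψ) where

    -- sliceᵢ and sliceᵢⱼ: the mass of the vectors whose one or two fixed coordinates
    -- are zero (0) or given nonzero values (1).
    private
      slice₁≡slice₀ : ∑ᶻ (suc k) ψ ≡ ∑ᶻ (suc k) (ψ ∘ suc)
      slice₁≡slice₀ = ∑ᶻ-balanced (suc k) ψ (sym H₁)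

      slice₀≡q*slice₀₀ : ∑ᶻ (suc k) (ψ ∘ suc) ≡ q * ∑ᶻ k ((ψ ∘ suc) ∘ suc)
      slice₀≡q*slice₀₀ =
        *-cancelˡ-≡ _ _ q (trans H₁ (trans (sym H₂) (*-assoc q q (∑ᶻ k ((ψ ∘ suc) ∘ suc)))))

      slice₀₁≡slice₀₀ : ∑ᶻ k (ψ ∘ suc) ≡ ∑ᶻ k ((ψ ∘ suc) ∘ suc)
      slice₀₁≡slice₀₀ = ∑ᶻ-balanced k (ψ ∘ suc) slice₀≡q*slice₀₀

      slice₁₁≡slice₀₀ : ∑ᶻ k ψ ≡ ∑ᶻ k ((ψ ∘ suc) ∘ suc)
      slice₁₁≡slice₀₀ = trans (∑ᶻ-balanced k ψ slice₁≡q*slice₀₁) slice₀₁≡slice₀₀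
        where
        slice₁≡q*slice₀₁ : ∑ᶻ (suc k) ψ ≡ q * ∑ᶻ k (ψ ∘ suc)
        slice₁≡q*slice₀₁ = trans slice₁≡slice₀ (trans slice₀≡q*slice₀₀ (cong (q *_) (sym slice₀₁≡slice₀₀)))

      slice[g,g′]≡slice₀₀ : ∀ (g g′ : Fin q) →
        ∑ᶻ k (λ m → ψ (numZeros [ g ] + (numZeros [ g′ ] + m))) ≡ ∑ᶻ k ((ψ ∘ suc) ∘ suc)
      slice[g,g′]≡slice₀₀ zero    zero    = refl
      slice[g,g′]≡slice₀₀ zero    (suc _) = slice₀₁≡slice₀₀
      slice[g,g′]≡slice₀₀ (suc _) zero    = slice₀₁≡slice₀₀
      slice[g,g′]≡slice₀₀ (suc _) (suc _) = slice₁₁≡slice₀₀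

    coordinate-mass : ∀ (g : Fin q) → q * ∑ᶻ (suc k) (λ m → ψ (numZeros [ g ] + m)) ≡ ∑ᶻ (suc (suc k)) ψ
    coordinate-mass zero    = H₁
    coordinate-mass (suc _) = trans (cong (q *_) slice₁≡slice₀) H₁

    coordinates-mass : ∀ (g g′ : Fin q) →
      q * q * ∑ᶻ k (λ m → ψ (numZeros [ g ] + (numZeros [ g′ ] + m))) ≡ ∑ᶻ (suc (suc k)) ψ
    coordinates-mass g g′ = trans (cong (q * q *_) (slice[g,g′]≡slice₀₀ g g′)) H₂

module SymmetricDistribution (p k : ℕ) (ψ : ℕ → ℕ)
                             .{{_ : NonZero (ZeroCounts.∑ᶻ (suc p) (suc (suc k)) ψ)}} where

  open ZeroCounts (suc p)

  private
    q K D : ℕ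
    q = suc (suc p)
    K = suc (suc k)
    D = ∑ᶻ K ψ

  μ : Vec (Fin q) K → ℚ
  μ x = ψ (numZeros x) ÷ D

  μ-supported : (Q : ℕ → Set) → (∀ j → ψ j ≢ 0 → Q j) → Supports K q (Q ∘ numZeros) μ
  μ-supported Q ψ≢0⇒Q x μx≢0 =
    ψ≢0⇒Q (numZeros x) (λ ψ≡0 → μx≢0 (trans (cong (_÷ D) ψ≡0) (ℚ.0/n≡0 D)))

  -- The hypotheses say that the number of zeros has the first two factorial moments
  -- K/q and K(K-1)/q² of a Binomial(K, 1/q) variable.
  moments⇒balancedPairwiseIndependent :
    q * ∑ᶻ K (λ j → j * ψ j) ≡ K * D →
    q * q * ∑ᶻ K (λ j → j * pred j * ψ j) ≡ K * suc k * D →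
    BalancedPairwiseIndependent K q μ
  moments⇒balancedPairwiseIndependent mean factorialMoment = isDistribution , Pr₁≡1/q , Pr₂≡1/q²
    where
    open ≡-Reasoning

    swap : ∀ x y z → x * (y * z) ≡ y * (x * z)
    swap = solve-∀

    H₁ : q * ∑ᶻ (suc k) (ψ ∘ suc) ≡ D
    H₁ = *-cancelˡ-≡ _ _ K (begin
      K * (q * ∑ᶻ (suc k) (ψ ∘ suc)) ≡⟨ swap K q (∑ᶻ (suc k) (ψ ∘ suc)) ⟩
      q * (K * ∑ᶻ (suc k) (ψ ∘ suc)) ≡⟨ cong (q *_) (∑ᶻ-falling (suc k) ψ) ⟩
      q * ∑ᶻ K (λ j → j * ψ j)       ≡⟨ mean ⟩
      K * D                          ∎)

    H₂ : q * q * ∑ᶻ k ((ψ ∘ suc) ∘ suc) ≡ D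
    H₂ = *-cancelˡ-≡ _ _ (K * suc k) (begin
      K * suc k * (q * q * ∑ᶻ k ((ψ ∘ suc) ∘ suc)) ≡⟨ swap (K * suc k) (q * q) (∑ᶻ k ((ψ ∘ suc) ∘ suc)) ⟩
      q * q * (K * suc k * ∑ᶻ k ((ψ ∘ suc) ∘ suc)) ≡⟨ cong (q * q *_) (∑ᶻ-falling₂ k ψ) ⟩
      q * q * ∑ᶻ K (λ j → j * pred j * ψ j)        ≡⟨ factorialMoment ⟩
      K * suc k * D                                ∎)

    isDistribution : IsDistribution K q μ
    isDistribution = (λ x → ÷-nonNeg (ψ (numZeros x)) D) , (begin
      sumAll K q μ                ≡⟨ sumAll-÷ μ (ψ ∘ numZeros) D (λ _ → refl) ⟩
      ∑ᵛ {q} K (ψ ∘ numZeros) ÷ D ≡⟨ cong (_÷ D) (∑ᵛ-numZeros K ψ) ⟩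
      D ÷ D                       ≡⟨ ÷≡1÷ D 1 D (*-identityˡ D) ⟩
      1ℚ                          ∎)

    Pr₁≡1/q : ∀ i g → Pr₁ K q μ i g ≡ inv q
    Pr₁≡1/q i g = begin
      Pr₁ K q μ i g
        ≡⟨ sumAll-÷ _ _ D (λ x → if-÷ ⌊ lookup x i ≟ᶠ g ⌋ (ψ (numZeros x)) D) ⟩
      ∑ᵛ K (λ x → if ⌊ lookup x i ≟ᶠ g ⌋ then ψ (numZeros x) else 0) ÷ D
        ≡⟨ cong (_÷ D) (∑ᵛ-coordinate (suc k) i g ψ) ⟩
      ∑ᶻ (suc k) (λ m → ψ (numZeros [ g ] + m)) ÷ D
        ≡⟨ ÷≡1÷ (∑ᶻ (suc k) (λ m → ψ (numZeros [ g ] + m))) q D (coordinate-mass p k ψ H₁ H₂ g) ⟩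
      inv q ∎

    Pr₂≡1/q² : ∀ i j → i ≢ j → ∀ g g′ → Pr₂ K q μ i g j g′ ≡ inv (q * q)
    Pr₂≡1/q² i j i≢j g g′ = begin
      Pr₂ K q μ i g j g′
        ≡⟨ sumAll-÷ _ _ D (λ x → if-×-dec-÷ (lookup x i ≟ᶠ g) (lookup x j ≟ᶠ g′) (ψ (numZeros x)) D) ⟩
      ∑ᵛ K (λ x → if ⌊ lookup x i ≟ᶠ g ⌋
                    then (if ⌊ lookup x j ≟ᶠ g′ ⌋ then ψ (numZeros x) else 0) else 0) ÷ D
        ≡⟨ cong (_÷ D) (∑ᵛ-coordinates k i j i≢j g g′ ψ) ⟩
      ∑ᶻ k (λ m → ψ (numZeros [ g ] + (numZeros [ g′ ] + m))) ÷ D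
        ≡⟨ ÷≡1÷ (∑ᶻ k (λ m → ψ (numZeros [ g ] + (numZeros [ g′ ] + m)))) (q * q) D
             (coordinates-mass p k ψ H₁ H₂ g g′) ⟩
      inv (q * q) ∎

-- A law for the number of zeros Z with P(Z = mᵢ) ∝ aᵢ, supported on parity r, with the
-- mean k/q and second moment k(k+q-1)/q² of a Binomial(k, 1/q) variable.
record ZeroCountLaw (q k r : ℕ) : Set where
  field
    m₁ m₂ m₃ a₁ a₂ a₃ : ℕ
    m₁≤k : m₁ ≤ k
    m₂≤k : m₂ ≤ k
    m₃≤k : m₃ ≤ k
    m₁%2≡r : m₁ % 2 ≡ r
    m₂%2≡r : m₂ % 2 ≡ r
    m₃%2≡r : m₃ % 2 ≡ r
    mass≢0 : a₁ + a₂ + a₃ ≢ 0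
    mean : q * (a₁ * m₁ + a₂ * m₂ + a₃ * m₃) ≡ k * (a₁ + a₂ + a₃)
    secondMoment : q * q * (a₁ * (m₁ * m₁) + a₂ * (m₂ * m₂) + a₃ * (m₃ * m₃)) + k * (a₁ + a₂ + a₃)
                   ≡ k * (k + q) * (a₁ + a₂ + a₃)

m*m≡m*pred[m]+m : ∀ m → m * m ≡ m * pred m + m
m*m≡m*pred[m]+m zero    = refl
m*m≡m*pred[m]+m (suc m) = trans (*-suc (suc m) m) (+-comm (suc m) (suc m * m))

raw⇒factorialMoment : ∀ q k A E₁ E₂ → q * E₁ ≡ suc k * A →
  q * q * (E₂ + E₁) + suc k * A ≡ suc k * (suc k + q) * A → q * q * E₂ ≡ suc k * k * A
raw⇒factorialMoment q k A E₁ E₂ mean second =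
  +-cancelʳ-≡ (suc k * A) _ _ (+-cancelʳ-≡ (q * (suc k * A)) _ _ (begin
    q * q * E₂ + suc k * A + q * (suc k * A)  ≡⟨ cong (λ t → q * q * E₂ + suc k * A + q * t) mean ⟨
    q * q * E₂ + suc k * A + q * (q * E₁)     ≡⟨ regroup q (suc k * A) E₁ E₂ ⟩
    q * q * (E₂ + E₁) + suc k * A             ≡⟨ second ⟩
    suc k * (suc k + q) * A                   ≡⟨ expand q k A ⟩
    suc k * k * A + suc k * A + q * (suc k * A) ∎))
  where
  open ≡-Reasoning
  regroup : ∀ q B E₁ E₂ → q * q * E₂ + B + q * (q * E₁) ≡ q * q * (E₂ + E₁) + B
  regroup = solve-∀
  expand : ∀ q k A → suc k * (suc k + q) * A ≡ suc k * k * A + suc k * A + q * (suc k * A)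
  expand = solve-∀

rescale : ∀ C x y a b → x * a ≡ y * b → x * (C * a) ≡ y * (C * b)
rescale C x y a b x*a≡y*b = begin
  x * (C * a) ≡⟨ swap x C a ⟩
  C * (x * a) ≡⟨ cong (C *_) x*a≡y*b ⟩
  C * (y * b) ≡⟨ swap C y b ⟩
  y * (C * b) ∎
  where
  open ≡-Reasoning
  swap : ∀ x y z → x * (y * z) ≡ y * (x * z)
  swap = solve-∀

module _ {p k r : ℕ} (L : ZeroCountLaw (suc (suc p)) (suc (suc k)) r) where

  open ZeroCountLaw L
  open ZeroCounts (suc p)

  private
    q K c₁ c₂ c₃ mass : ℕ
    q  = suc (suc p)
    K  = suc (suc k)
    c₁ = ∑ᶻ K (δ m₁)
    c₂ = ∑ᶻ K (δ m₂)
    c₃ = ∑ᶻ K (δ m₃)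
    mass = a₁ + a₂ + a₃

    𝔼 : (ℕ → ℕ) → ℕ
    𝔼 f = a₁ * f m₁ + a₂ * f m₂ + a₃ * f m₃

    -- cᵢ counts the vectors with mᵢ zeros, so ψ gives each of them the weight aᵢ / cᵢ,
    -- scaled by c₁ c₂ c₃ to stay in ℕ.
    ψ : ℕ → ℕ
    ψ j = a₁ * (c₂ * c₃) * δ m₁ j + a₂ * (c₁ * c₃) * δ m₂ j + a₃ * (c₁ * c₂) * δ m₃ j

    ∑ᶻ-*δ : ∀ f m → ∑ᶻ K (λ j → f j * δ m j) ≡ f m * ∑ᶻ K (δ m)
    ∑ᶻ-*δ f m = trans (∑ᶻ-cong K (*-δ f m)) (∑ᶻ-* K (f m) (δ m))

    ∑ᶻ-*ψ : ∀ f → ∑ᶻ K (λ j → f j * ψ j) ≡ c₁ * c₂ * c₃ * 𝔼 f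
    ∑ᶻ-*ψ f = begin
      ∑ᶻ K (λ j → f j * ψ j)
        ≡⟨ ∑ᶻ-cong K (λ j → distribute (f j) b₁ b₂ b₃ (δ m₁ j) (δ m₂ j) (δ m₃ j)) ⟩
      ∑ᶻ K (λ j → b₁ * (f j * δ m₁ j) + b₂ * (f j * δ m₂ j) + b₃ * (f j * δ m₃ j))
        ≡⟨ ∑ᶻ-linear₃ K b₁ b₂ b₃ (λ j → f j * δ m₁ j) (λ j → f j * δ m₂ j) (λ j → f j * δ m₃ j) ⟩
      b₁ * ∑ᶻ K (λ j → f j * δ m₁ j) + b₂ * ∑ᶻ K (λ j → f j * δ m₂ j) + b₃ * ∑ᶻ K (λ j → f j * δ m₃ j)
        ≡⟨ cong₂ _+_ (cong₂ _+_ (cong (b₁ *_) (∑ᶻ-*δ f m₁)) (cong (b₂ *_) (∑ᶻ-*δ f m₂)))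
                     (cong (b₃ *_) (∑ᶻ-*δ f m₃)) ⟩
      b₁ * (f m₁ * c₁) + b₂ * (f m₂ * c₂) + b₃ * (f m₃ * c₃)
        ≡⟨ regroup a₁ a₂ a₃ c₁ c₂ c₃ (f m₁) (f m₂) (f m₃) ⟩
      c₁ * c₂ * c₃ * 𝔼 f ∎
      where
      open ≡-Reasoning
      b₁ = a₁ * (c₂ * c₃)
      b₂ = a₂ * (c₁ * c₃)
      b₃ = a₃ * (c₁ * c₂)
      distribute : ∀ x b₁ b₂ b₃ y₁ y₂ y₃ →
        x * (b₁ * y₁ + b₂ * y₂ + b₃ * y₃) ≡ b₁ * (x * y₁) + b₂ * (x * y₂) + b₃ * (x * y₃)
      distribute = solve-∀
      regroup : ∀ a₁ a₂ a₃ c₁ c₂ c₃ x₁ x₂ x₃ →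
        a₁ * (c₂ * c₃) * (x₁ * c₁) + a₂ * (c₁ * c₃) * (x₂ * c₂) + a₃ * (c₁ * c₂) * (x₃ * c₃)
          ≡ c₁ * c₂ * c₃ * (a₁ * x₁ + a₂ * x₂ + a₃ * x₃)
      regroup = solve-∀

    ∑ᶻψ≡ : ∑ᶻ K ψ ≡ c₁ * c₂ * c₃ * mass
    ∑ᶻψ≡ = begin
      ∑ᶻ K ψ                      ≡⟨ ∑ᶻ-cong K (λ j → *-identityˡ (ψ j)) ⟨
      ∑ᶻ K (λ j → 1 * ψ j)        ≡⟨ ∑ᶻ-*ψ (λ _ → 1) ⟩
      c₁ * c₂ * c₃ * 𝔼 (λ _ → 1)  ≡⟨ cong (c₁ * c₂ * c₃ *_) (drop-ones a₁ a₂ a₃) ⟩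
      c₁ * c₂ * c₃ * mass         ∎
      where
      open ≡-Reasoning
      drop-ones : ∀ a₁ a₂ a₃ → a₁ * 1 + a₂ * 1 + a₃ * 1 ≡ a₁ + a₂ + a₃
      drop-ones = solve-∀

    ∑ᶻψ-nonZero : NonZero (∑ᶻ K ψ)
    ∑ᶻψ-nonZero = subst NonZero (sym ∑ᶻψ≡) (m*n≢0 (c₁ * c₂ * c₃) mass)
      where
      instance
        _ = >-nonZero (∑ᶻ-δ-pos p m₁≤k)
        _ = >-nonZero (∑ᶻ-δ-pos p m₂≤k)
        _ = >-nonZero (∑ᶻ-δ-pos p m₃≤k)
        _ = m*n≢0 c₁ c₂
        _ = m*n≢0 (c₁ * c₂) c₃
        _ = ≢-nonZero mass≢0

    mean-ψ : q * ∑ᶻ K (λ j → j * ψ j) ≡ K * ∑ᶻ K ψ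
    mean-ψ = trans (cong (q *_) (∑ᶻ-*ψ id))
      (trans (rescale (c₁ * c₂ * c₃) q K (𝔼 id) mass mean) (cong (K *_) (sym ∑ᶻψ≡)))

    factorialMoment-ψ : q * q * ∑ᶻ K (λ j → j * pred j * ψ j) ≡ K * suc k * ∑ᶻ K ψ
    factorialMoment-ψ = trans (cong (q * q *_) (∑ᶻ-*ψ (λ j → j * pred j)))
      (trans (rescale (c₁ * c₂ * c₃) (q * q) (K * suc k) (𝔼 (λ j → j * pred j)) mass factorialMoment)
             (cong (K * suc k *_) (sym ∑ᶻψ≡)))
      where
      𝔼-square : 𝔼 (λ j → j * j) ≡ 𝔼 (λ j → j * pred j) + 𝔼 id
      𝔼-square = trans
        (cong₂ _+_ (cong₂ _+_ (cong (a₁ *_) (m*m≡m*pred[m]+m m₁)) (cong (a₂ *_) (m*m≡m*pred[m]+m m₂)))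
                   (cong (a₃ *_) (m*m≡m*pred[m]+m m₃)))
        (split a₁ a₂ a₃ (m₁ * pred m₁) (m₂ * pred m₂) (m₃ * pred m₃) m₁ m₂ m₃)
        where
        split : ∀ a₁ a₂ a₃ x₁ x₂ x₃ y₁ y₂ y₃ →
          a₁ * (x₁ + y₁) + a₂ * (x₂ + y₂) + a₃ * (x₃ + y₃)
            ≡ (a₁ * x₁ + a₂ * x₂ + a₃ * x₃) + (a₁ * y₁ + a₂ * y₂ + a₃ * y₃)
        split = solve-∀
      factorialMoment : q * q * 𝔼 (λ j → j * pred j) ≡ K * suc k * mass
      factorialMoment = raw⇒factorialMoment q (suc k) mass (𝔼 id) (𝔼 (λ j → j * pred j)) mean
        (trans (cong (λ t → q * q * t + K * mass) (sym 𝔼-square)) secondMoment)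

    ψ-support : ∀ j → ψ j ≢ 0 → j % 2 ≡ r
    ψ-support j ψj≢0 with m₁ ≟ j | m₂ ≟ j | m₃ ≟ j
    ... | yes refl | _        | _        = m₁%2≡r
    ... | no _     | yes refl | _        = m₂%2≡r
    ... | no _     | no _     | yes refl = m₃%2≡r
    ... | no m₁≢j  | no m₂≢j  | no m₃≢j  = ⊥-elim (ψj≢0 (begin
      ψ j
        ≡⟨ cong₂ _+_ (cong₂ _+_ (cong (b₁ *_) (δ-≢ m₁≢j)) (cong (b₂ *_) (δ-≢ m₂≢j)))
                     (cong (b₃ *_) (δ-≢ m₃≢j)) ⟩
      b₁ * 0 + b₂ * 0 + b₃ * 0
        ≡⟨ zeros b₁ b₂ b₃ ⟩
      0 ∎))
      where
      open ≡-Reasoning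
      b₁ = a₁ * (c₂ * c₃)
      b₂ = a₂ * (c₁ * c₃)
      b₃ = a₃ * (c₁ * c₂)
      zeros : ∀ x y z → x * 0 + y * 0 + z * 0 ≡ 0
      zeros = solve-∀

  ZeroCountLaw⇒SupportsBPI : SupportsBPI K q (λ y → numZeros y % 2 ≡ r)
  ZeroCountLaw⇒SupportsBPI =
    μ , moments⇒balancedPairwiseIndependent mean-ψ factorialMoment-ψ ,
    μ-supported (λ j → j % 2 ≡ r) ψ-support
    where open SymmetricDistribution p k ψ {{∑ᶻψ-nonZero}}

[1+n]%2≡0⇒n%2≡1 : ∀ n → suc n % 2 ≡ 0 → n % 2 ≡ 1
[1+n]%2≡0⇒n%2≡1 (suc zero)    _ = refl
[1+n]%2≡0⇒n%2≡1 (suc (suc n)) h = [1+n]%2≡0⇒n%2≡1 n h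

-- On the three given points the two moment equations determine the weights up to scale.
law-q+2-even : ∀ p → (4 + p) % 2 ≡ 0 → ZeroCountLaw (2 + p) (4 + p) 0
law-q+2-even p k%2≡0 = record
  { m₁ = 0 ; m₂ = 2 ; m₃ = 4 + p
  ; a₁ = (2 + p) * (1 + p) * (1 + p) ; a₂ = (1 + p) * (3 + p) * (4 + p) ; a₃ = 2
  ; m₁≤k = z≤n ; m₂≤k = m≤m+n 2 (2 + p) ; m₃≤k = ≤-refl
  ; m₁%2≡r = refl ; m₂%2≡r = refl ; m₃%2≡r = k%2≡0
  ; mass≢0 = λ ()
  ; mean = solve (p List.∷ List.[])
  ; secondMoment = solve (p List.∷ List.[])
  }

law-q+2-odd : ∀ p → (4 + p) % 2 ≡ 0 → ZeroCountLaw (2 + p) (4 + p) 1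
law-q+2-odd p k%2≡0 = record
  { m₁ = 1 ; m₂ = 3 ; m₃ = 3 + p
  ; a₁ = (1 + p) * (8 + 9 * p + 2 * (p * p)) ; a₂ = (2 + p) * (3 + p) ; a₃ = 2 * (1 + p)
  ; m₁≤k = m≤m+n 1 (3 + p) ; m₂≤k = m≤m+n 3 (1 + p) ; m₃≤k = n≤1+n (3 + p)
  ; m₁%2≡r = refl ; m₂%2≡r = refl ; m₃%2≡r = [1+n]%2≡0⇒n%2≡1 (3 + p) k%2≡0
  ; mass≢0 = λ ()
  ; mean = solve (p List.∷ List.[])
  ; secondMoment = solve (p List.∷ List.[])
  }

law-q+3-even : ∀ p → ZeroCountLaw (2 + p) (5 + p) 0
law-q+3-even p = record
  { m₁ = 0 ; m₂ = 2 ; m₃ = 4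
  ; a₁ = (1 + p) * (1 + 2 * p) ; a₂ = 2 * (1 + p) * (5 + p) ; a₃ = 5 + p
  ; m₁≤k = z≤n ; m₂≤k = m≤m+n 2 (3 + p) ; m₃≤k = m≤m+n 4 (1 + p)
  ; m₁%2≡r = refl ; m₂%2≡r = refl ; m₃%2≡r = refl
  ; mass≢0 = λ ()
  ; mean = solve (p List.∷ List.[])
  ; secondMoment = solve (p List.∷ List.[])
  }

law-q+3-odd : ∀ p → (5 + p) % 2 ≡ 1 → ZeroCountLaw (2 + p) (5 + p) 1
law-q+3-odd p k%2≡1 = record
  { m₁ = 1 ; m₂ = 3 ; m₃ = 5 + p
  ; a₁ = (2 + p) * (1 + p) * (1 + p) * (5 + p) ; a₂ = (1 + p) * (4 + p) * (5 + p) ; a₃ = 2 + p * p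
  ; m₁≤k = m≤m+n 1 (4 + p) ; m₂≤k = m≤m+n 3 (2 + p) ; m₃≤k = ≤-refl
  ; m₁%2≡r = refl ; m₂%2≡r = refl ; m₃%2≡r = k%2≡1
  ; mass≢0 = λ ()
  ; mean = solve (p List.∷ List.[])
  ; secondMoment = solve (p List.∷ List.[])
  }

law-q+4-even : ∀ p → ZeroCountLaw (2 + p) (6 + p) 0
law-q+4-even p = record
  { m₁ = 0 ; m₂ = 2 ; m₃ = 4
  ; a₁ = 2 + 3 * p + 4 * (p * p) ; a₂ = 2 * (6 + p) * (1 + 2 * p) ; a₃ = 3 * (6 + p)
  ; m₁≤k = z≤n ; m₂≤k = m≤m+n 2 (4 + p) ; m₃≤k = m≤m+n 4 (2 + p)
  ; m₁%2≡r = refl ; m₂%2≡r = refl ; m₃%2≡r = refl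
  ; mass≢0 = λ ()
  ; mean = solve (p List.∷ List.[])
  ; secondMoment = solve (p List.∷ List.[])
  }

law-q+4-odd : ∀ p → (6 + p) % 2 ≡ 0 → ZeroCountLaw (2 + p) (6 + p) 1
law-q+4-odd p k%2≡0 = record
  { m₁ = 1 ; m₂ = 3 ; m₃ = 5 + p
  ; a₁ = (1 + p) * (2 + p) * (6 + 15 * p + 13 * (p * p) + 2 * (p * p * p))
  ; a₂ = (1 + p) * (4 + p) * (5 + p) * (2 + 3 * p)
  ; a₃ = 2 * (6 + 5 * p + p * p * p)
  ; m₁≤k = m≤m+n 1 (5 + p) ; m₂≤k = m≤m+n 3 (3 + p) ; m₃≤k = n≤1+n (5 + p)
  ; m₁%2≡r = refl ; m₂%2≡r = refl ; m₃%2≡r = [1+n]%2≡0⇒n%2≡1 (5 + p) k%2≡0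
  ; mass≢0 = λ ()
  ; mean = solve (p List.∷ List.[])
  ; secondMoment = solve (p List.∷ List.[])
  }

q+c≡k⇒q≡2+p : ∀ c {q k} → q + c ≡ k → 2 + c ≤ k → ∃[ p ] q ≡ 2 + p × k ≡ 2 + c + p
q+c≡k⇒q≡2+p c {q} refl 2+c≤q+c with +-cancelʳ-≤ c 2 q 2+c≤q+c
... | s≤s (s≤s (z≤n {n = p})) = p , refl , cong (2 +_) (+-comm p c)

lemma4 : (k q : ℕ)
    → ((k % 2 ≡ 0 × 4 ≤ k × q + 2 ≡ k)
       ⊎ (k % 2 ≡ 1 × 5 ≤ k × q + 3 ≡ k)
       ⊎ (k % 2 ≡ 0 × 6 ≤ k × q + 4 ≡ k))
    → SupportsBPI k q (P'odd k q) × SupportsBPI k q (P'even k q)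
lemma4 k q (inj₁ (k%2≡0 , 4≤k , q+2≡k)) with q+c≡k⇒q≡2+p 2 q+2≡k 4≤k
... | p , refl , refl =
  ZeroCountLaw⇒SupportsBPI (law-q+2-odd p k%2≡0) , ZeroCountLaw⇒SupportsBPI (law-q+2-even p k%2≡0)
lemma4 k q (inj₂ (inj₁ (k%2≡1 , 5≤k , q+3≡k))) with q+c≡k⇒q≡2+p 3 q+3≡k 5≤k
... | p , refl , refl =
  ZeroCountLaw⇒SupportsBPI (law-q+3-odd p k%2≡1) , ZeroCountLaw⇒SupportsBPI (law-q+3-even p)
lemma4 k q (inj₂ (inj₂ (k%2≡0 , 6≤k , q+4≡k))) with q+c≡k⇒q≡2+p 4 q+4≡k 6≤k
... | p , refl , refl =
  ZeroCountLaw⇒SupportsBPI (law-q+4-odd p k%2≡0) , ZeroCountLaw⇒SupportsBPI (law-q+4-even p)
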